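{- Let $(G,X)$ be a nondegenerate dessin d'famille with monodromy pair $(\sigma_\circ,\sigma_\bullet)$. Then $z(\sigma_\circ\sigma_\bullet)\ge|\pi_0(G)|$, the number of connected components of $G$.
   Context: Permutations compose functionally; $z(\pi)$ is the number of $\pi$-orbits (fixed points included). A bicolored graph is a finite multigraph with each vertex white or black and every edge joining a white and a black vertex; nondegenerate means every vertex is incident to an edge. A dessin d'famille $(G,X)$ is such a graph embedded in a connected oriented compact surface $X$ without boundary (no condition on the complement). Its monodromy pair: $\sigma_\circ$ (resp. $\sigma_\bullet$) sends each edge to the next edge around its white (resp. black) vertex in the cyclic order given by the orientation of $X$. -}

module Defs where

open import Data.Nat using (ℕ; zero; suc; _≤_)
open import Data.Nat.Properties using (_≤?_)
open import Data.Fin using (Fin; toℕ)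
open import Data.Fin.Permutation using (Permutation′; _⟨$⟩ʳ_; _∘ₚ_)
open import Data.List using (List; map; upTo; allFin; filter; length)
open import Data.List.Relation.Unary.All using (All; all?)
open import Data.Sum using (_⊎_; inj₁; inj₂)
open import Data.Product using (∃; _×_)
open import Function.Definitions using (Surjective)
open import Relation.Binary.PropositionalEquality using (_≡_)
open import Relation.Binary.Construct.Closure.ReflexiveTransitive using (Star)

_^_∙_ : ∀ {n} → Permutation′ n → ℕ → Fin n → Fin n
π ^ zero ∙ i = i
π ^ suc k ∙ i = π ⟨$⟩ʳ (π ^ k ∙ i)

-- functional composition: (π ∙∘ ρ) i = π (ρ i)   (stdlib ∘ₚ is diagrammatic)
_∙∘_ : ∀ {n} → Permutation′ n → Permutation′ n → Permutation′ n
π ∙∘ ρ = ρ ∘ₚ π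

-- the orbit of i, listed as i, π i, ..., π^(n-1) i (this covers the whole orbit)
orbit : ∀ {n} → Permutation′ n → Fin n → List (Fin n)
orbit {n} π i = map (λ k → π ^ k ∙ i) (upTo n)

-- z(π): number of orbits of π, counted via their least elements
z : ∀ {n} → Permutation′ n → ℕ
z {n} π = length (filter (λ i → all? (λ j → toℕ i ≤? toℕ j) (orbit π i)) (allFin n))

record BicoloredGraph : Set where
  field
    nW nB nE : ℕ
    white : Fin nE → Fin nW
    black : Fin nE → Fin nB

  Vertex : Set
  Vertex = Fin nW ⊎ Fin nB

  data Adj : Vertex → Vertex → Set where
    wb : ∀ e → Adj (inj₁ (white e)) (inj₂ (black e))
    bw : ∀ e → Adj (inj₂ (black e)) (inj₁ (white e))

  Connected : Vertex → Vertex → Set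
  Connected = Star Adj

  Nondegenerate : Set
  Nondegenerate = Surjective _≡_ _≡_ white × Surjective _≡_ _≡_ black

  -- σ is a rotation at vertices given by f: each cycle of σ is exactly the
  -- set of edges at one vertex (a cyclic order of the edges around it)
  IsRotation : ∀ {V : Set} → (Fin nE → V) → Permutation′ nE → Set
  IsRotation f σ = ∀ e e' → (f e ≡ f e' → ∃ λ k → σ ^ k ∙ e ≡ e')
                           × ((∃ λ k → σ ^ k ∙ e ≡ e') → f e ≡ f e')

  -- (σ∘, σ•) is the monodromy pair of an embedding of G in a connected
  -- oriented closed surface (equivalently: a rotation system on G)
  IsMonodromyPair : Permutation′ nE → Permutation′ nE → Set
  IsMonodromyPair σw σb = IsRotation white σw × IsRotation black σb

  -- |π₀(G)| ≤ m : any family of vertices in pairwise distinct components has size ≤ m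
  ComponentsAtMost : ℕ → Set
  ComponentsAtMost m = ∀ k (v : Fin k → Vertex) →
    (∀ i j → Connected (v i) (v j) → i ≡ j) → k ≤ m

module Submission where

open import Defs
open import Data.Fin.Permutation using (Permutation′; _⟨$⟩ʳ_)
open import Data.Nat using (ℕ; zero; suc; _+_; _≤_; _<_)
open import Data.Nat.Properties using (_≤?_; ≰⇒>)
open import Data.Nat.Induction using (<-wellFounded)
open import Induction.WellFounded using (Acc; acc)
open import Data.Fin using (Fin; toℕ)
open import Data.Fin.Properties using (injective⇒≤)
open import Data.List using (List; filter; allFin; length; lookup)
open import Data.List.Relation.Unary.All using (All; all?)
open import Data.List.Relation.Unary.All.Properties using (¬All⇒Any¬)
open import Data.List.Relation.Unary.Any using (satisfied; index)
open import Data.List.Relation.Unary.Any.Properties using (map⁻; lookup-index)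
open import Data.List.Membership.Propositional using (_∈_)
open import Data.List.Membership.Propositional.Properties using (∈-filter⁺; ∈-allFin)
open import Data.Sum using (inj₁; inj₂)
open import Data.Product using (∃; _×_; _,_; proj₁; proj₂)
open import Relation.Nullary using (yes; no)
open import Relation.Binary.PropositionalEquality using (_≡_; refl; sym; trans; cong; subst)
open import Relation.Binary.Construct.Closure.ReflexiveTransitive using (Star; ε; _◅_; _◅◅_; reverse)

-- Every edge e is joined to σ∘(σ•(e)) by the path white(e) – black(e) = black(σ• e) – white(σ• e)
-- = white(σ∘ σ• e), so each cycle of σ∘σ• lies in one component.  Picking the least edge of each
-- cycle gives z(σ∘σ•) edges, and by nondegeneracy every vertex is joined to one of them; two
-- vertices sent to the same edge are connected, whence the number of components is at most z.

module _ {n : ℕ} (π : Permutation′ n) where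

  ^-+ : ∀ k l i → π ^ k ∙ (π ^ l ∙ i) ≡ π ^ (k + l) ∙ i
  ^-+ zero    l i = refl
  ^-+ (suc k) l i = cong (π ⟨$⟩ʳ_) (^-+ k l i)

  IsOrbitMinimum : Fin n → Set
  IsOrbitMinimum i = All (λ j → toℕ i ≤ toℕ j) (orbit π i)

  -- z π is definitionally the length of this list.
  orbitMinima : List (Fin n)
  orbitMinima = filter (λ i → all? (λ j → toℕ i ≤? toℕ j) (orbit π i)) (allFin n)

  orbitMinimum∈orbitMinima : ∀ {i} → IsOrbitMinimum i → i ∈ orbitMinima
  orbitMinimum∈orbitMinima = ∈-filter⁺ (λ i → all? (λ j → toℕ i ≤? toℕ j) (orbit π i)) (∈-allFin _)

  reachesOrbitMinimum : ∀ i → ∃ λ k → IsOrbitMinimum (π ^ k ∙ i)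
  reachesOrbitMinimum i = go i (<-wellFounded (toℕ i))
    where
    go : ∀ i → Acc _<_ (toℕ i) → ∃ λ k → IsOrbitMinimum (π ^ k ∙ i)
    go i (acc rec) with all? (λ j → toℕ i ≤? toℕ j) (orbit π i)
    ... | yes minimal = 0 , minimal
    ... | no ¬minimal with satisfied (map⁻ (¬All⇒Any¬ (λ j → toℕ i ≤? toℕ j) (orbit π i) ¬minimal))
    ...   | l , i≰πˡi with go (π ^ l ∙ i) (rec (≰⇒> i≰πˡi))
    ...     | k , minimal = k + l , subst IsOrbitMinimum (^-+ k l i) minimal

  Star-^ : ∀ {a ℓ} {A : Set a} {R : A → A → Set ℓ} (f : Fin n → A) →
           (∀ i → Star R (f i) (f (π ⟨$⟩ʳ i))) → ∀ k i → Star R (f i) (f (π ^ k ∙ i))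
  Star-^ f step zero    i = ε
  Star-^ f step (suc k) i = Star-^ f step k i ◅◅ step (π ^ k ∙ i)

module _ (G : BicoloredGraph) where
  open BicoloredGraph G

  Connected-sym : ∀ {x y} → Connected x y → Connected y x
  Connected-sym = reverse λ where
    (wb e) → bw e
    (bw e) → wb e

  ≡⇒Connected : ∀ {x y} → x ≡ y → Connected x y
  ≡⇒Connected refl = ε

  IsRotation-step : ∀ {V : Set} {f : Fin nE → V} {σ} → IsRotation f σ → ∀ e → f e ≡ f (σ ⟨$⟩ʳ e)
  IsRotation-step rot e = proj₂ (rot e _) (1 , refl)

  white-connected-monodromy : ∀ {σw σb} → IsMonodromyPair σw σb → ∀ e →
    Connected (inj₁ (white e)) (inj₁ (white ((σw ∙∘ σb) ⟨$⟩ʳ e)))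
  white-connected-monodromy {σb = σb} (rotw , rotb) e =
    wb e ◅ ≡⇒Connected (cong inj₂ (IsRotation-step rotb e))
      ◅◅ bw (σb ⟨$⟩ʳ e) ◅ ≡⇒Connected (cong inj₁ (IsRotation-step rotw (σb ⟨$⟩ʳ e)))

  Nondegenerate⇒connected-white : Nondegenerate → ∀ x → ∃ λ e → Connected x (inj₁ (white e))
  Nondegenerate⇒connected-white (surjw , _) (inj₁ w) =
    let e , white-e≡w = surjw w in e , ≡⇒Connected (cong inj₁ (sym (white-e≡w refl)))
  Nondegenerate⇒connected-white (_ , surjb) (inj₂ b) =
    let e , black-e≡b = surjb b in e , ≡⇒Connected (cong inj₂ (sym (black-e≡b refl))) ◅◅ bw e ◅ ε

  componentsAtMost-length : (L : List (Fin nE)) →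
    (∀ x → ∃ λ e → e ∈ L × Connected x (inj₁ (white e))) → ComponentsAtMost (length L)
  componentsAtMost-length L cover k v distinct = injective⇒≤ {f = slot} slot-injective
    where
    slot : Fin k → Fin (length L)
    slot i = index (proj₁ (proj₂ (cover (v i))))

    slot-injective : ∀ {i j} → slot i ≡ slot j → i ≡ j
    slot-injective {i} {j} eq with cover (v i) | cover (v j)
    ... | e , e∈L , vi~e | e′ , e′∈L , vj~e′ = distinct i j
      (vi~e ◅◅ ≡⇒Connected (cong (λ e → inj₁ (white e)) e≡e′) ◅◅ Connected-sym vj~e′)
      where
      e≡e′ : e ≡ e′
      e≡e′ = trans (lookup-index e∈L) (trans (cong (lookup L) eq) (sym (lookup-index e′∈L)))

mainTheorem13 : (G : BicoloredGraph) → BicoloredGraph.Nondegenerate G →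
    (σw σb : Permutation′ (BicoloredGraph.nE G)) →
    BicoloredGraph.IsMonodromyPair G σw σb →
    BicoloredGraph.ComponentsAtMost G (z (σw ∙∘ σb))
mainTheorem13 G nd σw σb mp = componentsAtMost-length G (orbitMinima τ) cover
  where
  open BicoloredGraph G
  τ = σw ∙∘ σb

  cover : ∀ x → ∃ λ e → e ∈ orbitMinima τ × Connected x (inj₁ (white e))
  cover x with Nondegenerate⇒connected-white G nd x
  ... | e , x~e with reachesOrbitMinimum τ e
  ...   | k , minimal = τ ^ k ∙ e , orbitMinimum∈orbitMinima τ minimal ,
                        x~e ◅◅ Star-^ τ (λ e → inj₁ (white e)) (white-connected-monodromy G mp) k e
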